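{- Let $\mathbb{F}$ be a finite field, $H$ a nonempty subset of $\mathbb{F}$, and $\gamma:=\sum_{\alpha\in H}\alpha$. For every polynomial $P\in\mathbb{F}[X_1,\dots,X_m]$ that is multilinear (individual degree at most $1$), $$\sum_{\vec\alpha\in H^m}P(\vec\alpha)=\begin{cases}P\big(\tfrac{\gamma}{|H|},\dots,\tfrac{\gamma}{|H|}\big)\cdot|H|^m & \text{if }\mathrm{char}(\mathbb{F})\nmid|H|,\\ \kappa\cdot\gamma^m & \text{if }\mathrm{char}(\mathbb{F})\mid|H|,\end{cases}$$ where $\kappa$ is the coefficient of $X_1\cdots X_m$ in $P$. -}

module Defs where

open import Level using (Level; _⊔_) renaming (suc to lsuc)
open import Algebra.Bundles using (CommutativeRing)
open import Data.Nat as ℕ using (ℕ; zero; suc; _≤_)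
open import Data.Nat.Divisibility using (_∣_)
open import Data.Fin using (Fin)
open import Data.Bool using (true; false)
open import Data.Product using (Σ; ∃; _×_; _,_)
open import Data.List as List using (List; []; _∷_; foldr; map; concatMap; filter; length)
open import Data.Vec as Vec using (Vec; []; _∷_; lookup; replicate)
import Data.Vec.Properties as VecP
open import Relation.Nullary using (¬_; Dec; yes; no)
import Data.List.Membership.Setoid as SetoidMembership
import Data.List.Relation.Unary.Unique.Setoid as SetoidUnique

record FiniteField (c ℓ : Level) : Set (lsuc (c ⊔ ℓ)) where
  field
    commutativeRing : CommutativeRing c ℓ
  open CommutativeRing commutativeRing public
  open SetoidMembership setoid using (_∈_)
  field
    0≉1      : ¬ (0# ≈ 1#)
    inv      : (x : Carrier) → ¬ (x ≈ 0#) → Carrier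
    inverseʳ : (x : Carrier) (x≉0 : ¬ (x ≈ 0#)) → (x * inv x x≉0) ≈ 1#
    elements : List Carrier
    complete : (x : Carrier) → x ∈ elements

module _ {c ℓ : Level} (F : FiniteField c ℓ) where
  open FiniteField F

  -- H ⊆ F is a list of pairwise distinct (w.r.t. ≈) elements of F
  Distinct : List Carrier → Set (c ⊔ ℓ)
  Distinct = SetoidUnique.Unique setoid

  sumL : List Carrier → Carrier
  sumL = foldr _+_ 0#

  fromℕ : ℕ → Carrier
  fromℕ zero    = 0#
  fromℕ (suc n) = 1# + fromℕ n

  pow : Carrier → ℕ → Carrier
  pow x zero    = 1#
  pow x (suc n) = x * pow x n

  IsCharacteristic : ℕ → Set ℓ
  IsCharacteristic p = (n : ℕ) → ((fromℕ n ≈ 0# → p ∣ n) × (p ∣ n → fromℕ n ≈ 0#))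

  charNonZero : {p : ℕ} → IsCharacteristic p → (n : ℕ) → ¬ (p ∣ n) → ¬ (fromℕ n ≈ 0#)
  charNonZero ch n p∤n e with ch n
  ... | (to , _) = p∤n (to e)

  tuples : List Carrier → (m : ℕ) → List (Vec Carrier m)
  tuples H zero    = [] ∷ []
  tuples H (suc m) = concatMap (λ a → map (a ∷_) (tuples H m)) H

  -- Polynomials in F[X₁,…,Xₘ], as finite lists of terms (c , e) standing
  -- for c · X₁^e₁ ⋯ Xₘ^eₘ  (exponent vectors may repeat; coefficients add up).
  Poly : ℕ → Set c
  Poly m = List (Carrier × Vec ℕ m)

  evalMono : {m : ℕ} → Vec ℕ m → Vec Carrier m → Carrier
  evalMono []       []       = 1#
  evalMono (e ∷ es) (x ∷ xs) = pow x e * evalMono es xs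

  eval : {m : ℕ} → Poly m → Vec Carrier m → Carrier
  eval P x = sumL (map (λ { (a , e) → a * evalMono e x }) P)

  coeff : {m : ℕ} → Poly m → Vec ℕ m → Carrier
  coeff []             e = 0#
  coeff ((a , e') ∷ P) e with VecP.≡-dec ℕ._≟_ e' e
  ... | yes _ = a + coeff P e
  ... | no  _ = coeff P e

  Multilinear : {m : ℕ} → Poly m → Set ℓ
  Multilinear {m} P = (e : Vec ℕ m) → (∃ λ (i : Fin m) → 2 ≤ lookup e i) → coeff P e ≈ 0#

-- Expanding P into terms and summing each monomial over H^m factorises:
-- Σ_{H^m} X^e = ∏ᵢ s(eᵢ) with power sums s(k) = Σ_{a∈H} a^k.  For multilinear P
-- only s(0) = |H| and s(1) = γ occur, so the power sums may be replaced by any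
-- weights agreeing with them at 0 and 1.  If |H| is invertible, the weights
-- β^k |H| with β = γ/|H| turn the sum into P(β,…,β)|H|^m; if char F divides |H|,
-- then s(0) = 0 and only the monomial X₁⋯Xₘ survives, with weight γ^m.
module Submission where

open import Defs
open import Level using (Level)
open import Algebra.Bundles using (CommutativeSemiring)
import Algebra.Properties.CommutativeSemigroup as CommutativeSemigroupProperties
open import Data.Nat using (ℕ; zero; suc; _≤_; _<_; z≤n; s≤s; _≤?_; _≟_)
open import Data.Nat.Divisibility using (_∣_)
open import Data.Nat.Induction using (<-wellFounded)
open import Data.Nat.Properties using (≰⇒>; m≤n⇒m≤1+n)
open import Data.Product using (_×_; _,_; proj₂)
open import Data.Sum using (_⊎_; inj₁; inj₂; map₁)
open import Data.List using (List; []; _∷_; _++_; length; map; foldr; concatMap)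
open import Data.List.Properties using (map-∘; map-++)
open import Data.Vec using (Vec; []; _∷_; replicate)
import Data.Vec.Properties as VecP
open import Data.Vec.Relation.Unary.All using (All; []; _∷_)
open import Data.Vec.Relation.Unary.Any using (Any; here; there; index)
open import Data.Vec.Relation.Unary.Any.Properties using (lookup-index)
open import Data.Empty using (⊥-elim)
open import Induction.WellFounded using (Acc; acc)
open import Relation.Nullary using (¬_; yes; no)
open import Relation.Binary.PropositionalEquality as ≡ using (_≢_)
import Relation.Binary.Reasoning.Setoid as SetoidReasoning

module ListSum {c ℓ : Level} (R : CommutativeSemiring c ℓ) where
  open CommutativeSemiring R
  open SetoidReasoning setoid
  open CommutativeSemigroupProperties +-commutativeSemigroup using (interchange)

  sum : List Carrier → Carrier
  sum = foldr _+_ 0#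

  sum-++ : (xs ys : List Carrier) → sum (xs ++ ys) ≈ sum xs + sum ys
  sum-++ []       ys = sym (+-identityˡ _)
  sum-++ (x ∷ xs) ys = trans (+-congˡ (sum-++ xs ys)) (sym (+-assoc x _ _))

  module _ {a} {A : Set a} where

    sum-map-cong : {f g : A → Carrier} → (∀ x → f x ≈ g x) →
                   (xs : List A) → sum (map f xs) ≈ sum (map g xs)
    sum-map-cong f≈g []       = refl
    sum-map-cong f≈g (x ∷ xs) = +-cong (f≈g x) (sum-map-cong f≈g xs)

    sum-map-0# : (xs : List A) → sum (map (λ _ → 0#) xs) ≈ 0#
    sum-map-0# []       = refl
    sum-map-0# (x ∷ xs) = trans (+-identityˡ _) (sum-map-0# xs)

    sum-map-+ : (f g : A → Carrier) (xs : List A) →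
                sum (map (λ x → f x + g x) xs) ≈ sum (map f xs) + sum (map g xs)
    sum-map-+ f g []       = sym (+-identityˡ 0#)
    sum-map-+ f g (x ∷ xs) =
      trans (+-congˡ (sum-map-+ f g xs)) (interchange (f x) (g x) _ _)

    sum-map-*ˡ : (k : Carrier) (f : A → Carrier) (xs : List A) →
                 sum (map (λ x → k * f x) xs) ≈ k * sum (map f xs)
    sum-map-*ˡ k f []       = sym (zeroʳ k)
    sum-map-*ˡ k f (x ∷ xs) = trans (+-congˡ (sum-map-*ˡ k f xs)) (sym (distribˡ k (f x) _))

    sum-map-*ʳ : (k : Carrier) (f : A → Carrier) (xs : List A) →
                 sum (map (λ x → f x * k) xs) ≈ sum (map f xs) * k
    sum-map-*ʳ k f []       = sym (zeroˡ k)
    sum-map-*ʳ k f (x ∷ xs) = trans (+-congˡ (sum-map-*ʳ k f xs)) (sym (distribʳ k (f x) _))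

    sum-map-comm : ∀ {b} {B : Set b} (f : A → B → Carrier) (xs : List A) (ys : List B) →
                   sum (map (λ x → sum (map (f x) ys)) xs)
                     ≈ sum (map (λ y → sum (map (λ x → f x y) xs)) ys)
    sum-map-comm f xs []       = sum-map-0# xs
    sum-map-comm f xs (y ∷ ys) =
      trans (sum-map-+ (λ x → f x y) (λ x → sum (map (f x) ys)) xs)
            (+-congˡ (sum-map-comm f xs ys))

    sum-map-concatMap : ∀ {b} {B : Set b} (f : B → Carrier) (g : A → List B) (xs : List A) →
                        sum (map f (concatMap g xs)) ≈ sum (map (λ x → sum (map f (g x))) xs)
    sum-map-concatMap f g []       = refl
    sum-map-concatMap f g (x ∷ xs) = begin
      sum (map f (g x ++ concatMap g xs))
        ≡⟨ ≡.cong sum (map-++ f (g x) (concatMap g xs)) ⟩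
      sum (map f (g x) ++ map f (concatMap g xs))
        ≈⟨ sum-++ (map f (g x)) _ ⟩
      sum (map f (g x)) + sum (map f (concatMap g xs))
        ≈⟨ +-congˡ (sum-map-concatMap f g xs) ⟩
      sum (map f (g x)) + sum (map (λ x → sum (map f (g x))) xs) ∎

module PowerSums {c ℓ : Level} (F : FiniteField c ℓ) where
  open FiniteField F
  open SetoidReasoning setoid
  open ListSum commutativeSemiring public
  open CommutativeSemigroupProperties +-commutativeSemigroup using (x∙yz≈y∙xz)
  open CommutativeSemigroupProperties *-commutativeSemigroup using () renaming (interchange to *-interchange)

  sumTerms : {m : ℕ} → (Vec ℕ m → Carrier) → Poly F m → Carrier
  sumTerms f P = sum (map (λ { (a , e) → a * f e }) P)

  sumTerms-cong : {m : ℕ} {f g : Vec ℕ m → Carrier} → (∀ e → f e ≈ g e) →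
                  (P : Poly F m) → sumTerms f P ≈ sumTerms g P
  sumTerms-cong f≈g = sum-map-cong (λ { (a , e) → *-congˡ (f≈g e) })

  sumTerms-*ʳ : {m : ℕ} (f : Vec ℕ m → Carrier) (k : Carrier) (P : Poly F m) →
                sumTerms (λ e → f e * k) P ≈ sumTerms f P * k
  sumTerms-*ʳ f k P =
    trans (sum-map-cong (λ { (a , e) → sym (*-assoc a (f e) k) }) P)
          (sum-map-*ʳ k (λ { (a , e) → a * f e }) P)

  sumTerms-concentrated : {m : ℕ} {f : Vec ℕ m → Carrier} (e₀ : Vec ℕ m) →
                          (∀ e → e ≢ e₀ → f e ≈ 0#) →
                          (P : Poly F m) → sumTerms f P ≈ coeff F P e₀ * f e₀
  sumTerms-concentrated e₀ f≈0 []             = sym (zeroˡ _)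
  sumTerms-concentrated e₀ f≈0 ((a , e) ∷ P) with VecP.≡-dec _≟_ e e₀
  ... | yes ≡.refl = trans (+-congˡ (sumTerms-concentrated e₀ f≈0 P)) (sym (distribʳ _ a _))
  ... | no  e≢e₀   = trans (+-congʳ (trans (*-congˡ (f≈0 e e≢e₀)) (zeroʳ a)))
                           (trans (+-identityˡ _) (sumTerms-concentrated e₀ f≈0 P))

  removeExponent : {m : ℕ} → Vec ℕ m → Poly F m → Poly F m
  removeExponent e [] = []
  removeExponent e ((a , e′) ∷ P) with VecP.≡-dec _≟_ e′ e
  ... | yes _ = removeExponent e P
  ... | no  _ = (a , e′) ∷ removeExponent e P

  removeExponent-length : {m : ℕ} (e : Vec ℕ m) (P : Poly F m) →
                          length (removeExponent e P) ≤ length P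
  removeExponent-length e [] = z≤n
  removeExponent-length e ((a , e′) ∷ P) with VecP.≡-dec _≟_ e′ e
  ... | yes _ = m≤n⇒m≤1+n (removeExponent-length e P)
  ... | no  _ = s≤s (removeExponent-length e P)

  removeExponent-head-< : {m : ℕ} (a : Carrier) (e : Vec ℕ m) (P : Poly F m) →
                          length (removeExponent e ((a , e) ∷ P)) < length ((a , e) ∷ P)
  removeExponent-head-< a e P with VecP.≡-dec _≟_ e e
  ... | yes _   = s≤s (removeExponent-length e P)
  ... | no  e≢e = ⊥-elim (e≢e ≡.refl)

  coeff-removeExponent-≡ : {m : ℕ} (e : Vec ℕ m) (P : Poly F m) →
                           coeff F (removeExponent e P) e ≈ 0#
  coeff-removeExponent-≡ e [] = refl
  coeff-removeExponent-≡ e ((a , e′) ∷ P) with VecP.≡-dec _≟_ e′ e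
  ... | yes _ = coeff-removeExponent-≡ e P
  ... | no e′≢e with VecP.≡-dec _≟_ e′ e
  ...   | yes e′≡e = ⊥-elim (e′≢e e′≡e)
  ...   | no  _    = coeff-removeExponent-≡ e P

  coeff-removeExponent-≢ : {m : ℕ} {e e′ : Vec ℕ m} → e′ ≢ e → (P : Poly F m) →
                           coeff F (removeExponent e P) e′ ≈ coeff F P e′
  coeff-removeExponent-≢ e′≢e [] = refl
  coeff-removeExponent-≢ {e = e} {e′} e′≢e ((a , e″) ∷ P) with VecP.≡-dec _≟_ e″ e
  ... | yes ≡.refl with VecP.≡-dec _≟_ e e′
  ...   | yes e≡e′ = ⊥-elim (e′≢e (≡.sym e≡e′))
  ...   | no  _    = coeff-removeExponent-≢ e′≢e P
  coeff-removeExponent-≢ {e = e} {e′} e′≢e ((a , e″) ∷ P) | no _ with VecP.≡-dec _≟_ e″ e′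
  ...   | yes _ = +-congˡ (coeff-removeExponent-≢ e′≢e P)
  ...   | no  _ = coeff-removeExponent-≢ e′≢e P

  sumTerms-removeExponent : {m : ℕ} (f : Vec ℕ m → Carrier) (e : Vec ℕ m) (P : Poly F m) →
                            sumTerms f P ≈ coeff F P e * f e + sumTerms f (removeExponent e P)
  sumTerms-removeExponent f e [] = sym (trans (+-identityʳ _) (zeroˡ (f e)))
  sumTerms-removeExponent f e ((a , e′) ∷ P) with VecP.≡-dec _≟_ e′ e
  ... | yes ≡.refl = begin
    a * f e + sumTerms f P
      ≈⟨ +-congˡ (sumTerms-removeExponent f e P) ⟩
    a * f e + (coeff F P e * f e + sumTerms f (removeExponent e P))
      ≈⟨ sym (+-assoc _ _ _) ⟩
    (a * f e + coeff F P e * f e) + sumTerms f (removeExponent e P)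
      ≈⟨ +-congʳ (sym (distribʳ (f e) a _)) ⟩
    (a + coeff F P e) * f e + sumTerms f (removeExponent e P) ∎
  ... | no _ =
    trans (+-congˡ (sumTerms-removeExponent f e P)) (x∙yz≈y∙xz _ _ _)

  -- Terms may repeat an exponent, and only their total coefficient is known to
  -- vanish; so the terms of one exponent are gathered and removed together.
  sumTerms-cong-support : {m : ℕ} {f g : Vec ℕ m → Carrier} (P : Poly F m) →
                          (∀ e → coeff F P e ≈ 0# ⊎ f e ≈ g e) →
                          sumTerms f P ≈ sumTerms g P
  sumTerms-cong-support {f = f} {g} P = go P (<-wellFounded (length P))
    where
    *-cong-support : {k x y : Carrier} → k ≈ 0# ⊎ x ≈ y → k * x ≈ k * y
    *-cong-support (inj₁ k≈0) = trans (*-congʳ k≈0) (trans (zeroˡ _) (sym (trans (*-congʳ k≈0) (zeroˡ _))))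
    *-cong-support (inj₂ x≈y) = *-congˡ x≈y

    go : (P : Poly F _) → Acc _<_ (length P) →
         (∀ e → coeff F P e ≈ 0# ⊎ f e ≈ g e) → sumTerms f P ≈ sumTerms g P
    go [] _ _ = refl
    go Q@((a , e) ∷ P) (acc shorter) agree = begin
      sumTerms f Q
        ≈⟨ sumTerms-removeExponent f e Q ⟩
      coeff F Q e * f e + sumTerms f (removeExponent e Q)
        ≈⟨ +-cong (*-cong-support (agree e))
                  (go (removeExponent e Q) (shorter (removeExponent-head-< a e P)) agree′) ⟩
      coeff F Q e * g e + sumTerms g (removeExponent e Q)
        ≈⟨ sym (sumTerms-removeExponent g e Q) ⟩
      sumTerms g Q ∎
      where
      agree′ : ∀ e′ → coeff F (removeExponent e Q) e′ ≈ 0# ⊎ f e′ ≈ g e′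
      agree′ e′ with VecP.≡-dec _≟_ e′ e
      ... | yes ≡.refl = inj₁ (coeff-removeExponent-≡ e Q)
      ... | no  e′≢e   = map₁ (trans (coeff-removeExponent-≢ e′≢e Q)) (agree e′)

  prodMap : {m : ℕ} → (ℕ → Carrier) → Vec ℕ m → Carrier
  prodMap t []      = 1#
  prodMap t (k ∷ e) = t k * prodMap t e

  prodMap-cong-≤1 : {m : ℕ} {s t : ℕ → Carrier} → s 0 ≈ t 0 → s 1 ≈ t 1 →
                    {e : Vec ℕ m} → All (_≤ 1) e → prodMap s e ≈ prodMap t e
  prodMap-cong-≤1 s0≈t0 s1≈t1 []                 = refl
  prodMap-cong-≤1 s0≈t0 s1≈t1 (z≤n       ∷ e≤1) = *-cong s0≈t0 (prodMap-cong-≤1 s0≈t0 s1≈t1 e≤1)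
  prodMap-cong-≤1 s0≈t0 s1≈t1 (s≤s z≤n   ∷ e≤1) = *-cong s1≈t1 (prodMap-cong-≤1 s0≈t0 s1≈t1 e≤1)

  all≤1⊎any≥2 : {m : ℕ} (e : Vec ℕ m) → All (_≤ 1) e ⊎ Any (2 ≤_) e
  all≤1⊎any≥2 []      = inj₁ []
  all≤1⊎any≥2 (k ∷ e) with k ≤? 1 | all≤1⊎any≥2 e
  ... | yes k≤1 | inj₁ e≤1 = inj₁ (k≤1 ∷ e≤1)
  ... | yes _   | inj₂ e≥2 = inj₂ (there e≥2)
  ... | no  k≰1 | _        = inj₂ (here (≰⇒> k≰1))

  sumTerms-multilinear-cong : {m : ℕ} (P : Poly F m) → Multilinear F P →
                              {s t : ℕ → Carrier} → s 0 ≈ t 0 → s 1 ≈ t 1 →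
                              sumTerms (prodMap s) P ≈ sumTerms (prodMap t) P
  sumTerms-multilinear-cong P multilinear {s} {t} s0≈t0 s1≈t1 = sumTerms-cong-support P support
    where
    support : ∀ e → coeff F P e ≈ 0# ⊎ prodMap s e ≈ prodMap t e
    support e with all≤1⊎any≥2 e
    ... | inj₁ e≤1 = inj₂ (prodMap-cong-≤1 s0≈t0 s1≈t1 e≤1)
    ... | inj₂ e≥2 = inj₁ (multilinear e (index e≥2 , lookup-index e≥2))

  powerSum : List Carrier → ℕ → Carrier
  powerSum H k = sum (map (λ a → pow F a k) H)

  powerSum-0 : (H : List Carrier) → powerSum H 0 ≈ fromℕ F (length H)
  powerSum-0 []      = refl
  powerSum-0 (a ∷ H) = +-congˡ (powerSum-0 H)

  powerSum-1 : (H : List Carrier) → powerSum H 1 ≈ sumL F H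
  powerSum-1 []      = refl
  powerSum-1 (a ∷ H) = +-cong (*-identityʳ a) (powerSum-1 H)

  sum-tuples-suc : (H : List Carrier) {m : ℕ} (f : Vec Carrier (suc m) → Carrier) →
                   sum (map f (tuples F H (suc m)))
                     ≈ sum (map (λ a → sum (map (λ x → f (a ∷ x)) (tuples F H m))) H)
  sum-tuples-suc H {m} f =
    trans (sum-map-concatMap f (λ a → map (a ∷_) (tuples F H m)) H)
          (sum-map-cong (λ a → reflexive (≡.cong sum (≡.sym (map-∘ (tuples F H m))))) H)

  sum-tuples-evalMono : (H : List Carrier) {m : ℕ} (e : Vec ℕ m) →
                        sum (map (evalMono F e) (tuples F H m)) ≈ prodMap (powerSum H) e
  sum-tuples-evalMono H []            = +-identityʳ 1#
  sum-tuples-evalMono H {suc m} (k ∷ e) = begin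
    sum (map (evalMono F (k ∷ e)) (tuples F H (suc m)))
      ≈⟨ sum-tuples-suc H (evalMono F (k ∷ e)) ⟩
    sum (map (λ a → sum (map (λ x → pow F a k * evalMono F e x) Hᵐ)) H)
      ≈⟨ sum-map-cong (λ a → sum-map-*ˡ (pow F a k) (evalMono F e) Hᵐ) H ⟩
    sum (map (λ a → pow F a k * sum (map (evalMono F e) Hᵐ)) H)
      ≈⟨ sum-map-*ʳ _ (λ a → pow F a k) H ⟩
    powerSum H k * sum (map (evalMono F e) Hᵐ)
      ≈⟨ *-congˡ (sum-tuples-evalMono H e) ⟩
    powerSum H k * prodMap (powerSum H) e ∎
    where Hᵐ = tuples F H m

  sum-tuples-eval : (H : List Carrier) {m : ℕ} (P : Poly F m) →
                    sum (map (eval F P) (tuples F H m)) ≈ sumTerms (prodMap (powerSum H)) P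
  sum-tuples-eval H {m} P = begin
    sum (map (λ x → sum (map (term x) P)) Hᵐ)
      ≈⟨ sum-map-comm term Hᵐ P ⟩
    sum (map (λ { (a , e) → sum (map (λ x → a * evalMono F e x) Hᵐ) }) P)
      ≈⟨ sum-map-cong (λ { (a , e) → trans (sum-map-*ˡ a (evalMono F e) Hᵐ)
                                           (*-congˡ (sum-tuples-evalMono H e)) }) P ⟩
    sumTerms (prodMap (powerSum H)) P ∎
    where
    Hᵐ = tuples F H m
    term : Vec Carrier m → Carrier × Vec ℕ m → Carrier
    term x (a , e) = a * evalMono F e x

  prodMap-geometric : (β k : Carrier) {m : ℕ} (e : Vec ℕ m) →
                      prodMap (λ n → pow F β n * k) e ≈ evalMono F e (replicate m β) * pow F k m
  prodMap-geometric β k []      = sym (*-identityʳ 1#)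
  prodMap-geometric β k (n ∷ e) = trans (*-congˡ (prodMap-geometric β k e)) (*-interchange _ _ _ _)

  linearPart : Carrier → ℕ → Carrier
  linearPart γ 1 = γ
  linearPart γ _ = 0#

  prodMap-linearPart-ones : (γ : Carrier) (m : ℕ) → prodMap (linearPart γ) (replicate m 1) ≈ pow F γ m
  prodMap-linearPart-ones γ zero    = refl
  prodMap-linearPart-ones γ (suc m) = *-congˡ (prodMap-linearPart-ones γ m)

  prodMap-linearPart-≢ones : (γ : Carrier) {m : ℕ} (e : Vec ℕ m) →
                             e ≢ replicate m 1 → prodMap (linearPart γ) e ≈ 0#
  prodMap-linearPart-≢ones γ []                  e≢1 = ⊥-elim (e≢1 ≡.refl)
  prodMap-linearPart-≢ones γ (0           ∷ e) e≢1 = zeroˡ _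
  prodMap-linearPart-≢ones γ (1           ∷ e) e≢1 =
    trans (*-congˡ (prodMap-linearPart-≢ones γ e (λ e≡1 → e≢1 (≡.cong (1 ∷_) e≡1)))) (zeroʳ γ)
  prodMap-linearPart-≢ones γ (suc (suc k) ∷ e) e≢1 = zeroˡ _

  *-inv-cancelʳ : (x y : Carrier) (y≉0 : ¬ (y ≈ 0#)) → (x * inv y y≉0) * y ≈ x
  *-inv-cancelʳ x y y≉0 = begin
    (x * inv y y≉0) * y ≈⟨ *-assoc x _ y ⟩
    x * (inv y y≉0 * y) ≈⟨ *-congˡ (*-comm _ y) ⟩
    x * (y * inv y y≉0) ≈⟨ *-congˡ (inverseʳ y y≉0) ⟩
    x * 1#              ≈⟨ *-identityʳ x ⟩
    x                   ∎

theoremA3 : {c ℓ : Level} (F : FiniteField c ℓ) → let open FiniteField F in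
    (H : List Carrier) → Distinct F H → H ≢ [] →
    (m : ℕ) (P : Poly F m) → Multilinear F P →
    (p : ℕ) (isChar : IsCharacteristic F p) →
      ((p∤H : ¬ (p ∣ length H)) →
         sumL F (map (eval F P) (tuples F H m))
           ≈ eval F P (replicate m (sumL F H * inv (fromℕ F (length H)) (charNonZero F isChar (length H) p∤H)))
             * pow F (fromℕ F (length H)) m)
      × (p ∣ length H →
         sumL F (map (eval F P) (tuples F H m))
           ≈ coeff F P (replicate m 1) * pow F (sumL F H) m)
theoremA3 F H _ _ m P multilinear p isChar = coprimeCase , divisibleCase
  where
  open FiniteField F
  open PowerSums F
  open SetoidReasoning setoid
  n = fromℕ F (length H)
  γ = sumL F H

  coprimeCase : (p∤H : ¬ (p ∣ length H)) →
                sum (map (eval F P) (tuples F H m))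
                  ≈ eval F P (replicate m (γ * inv n (charNonZero F isChar (length H) p∤H))) * pow F n m
  coprimeCase p∤H = begin
    sum (map (eval F P) (tuples F H m))                    ≈⟨ sum-tuples-eval H P ⟩
    sumTerms (prodMap (powerSum H)) P                      ≈⟨ sumTerms-multilinear-cong P multilinear s₀ s₁ ⟩
    sumTerms (prodMap (λ k → pow F β k * n)) P             ≈⟨ sumTerms-cong (prodMap-geometric β n) P ⟩
    sumTerms (λ e → evalMono F e (replicate m β) * pow F n m) P ≈⟨ sumTerms-*ʳ _ _ P ⟩
    eval F P (replicate m β) * pow F n m                   ∎
    where
    β = γ * inv n (charNonZero F isChar (length H) p∤H)
    s₀ : powerSum H 0 ≈ 1# * n
    s₀ = trans (powerSum-0 H) (sym (*-identityˡ n))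
    s₁ : powerSum H 1 ≈ (β * 1#) * n
    s₁ = trans (powerSum-1 H) (sym (trans (*-congʳ (*-identityʳ β)) (*-inv-cancelʳ γ n _)))

  divisibleCase : p ∣ length H →
                  sum (map (eval F P) (tuples F H m)) ≈ coeff F P (replicate m 1) * pow F γ m
  divisibleCase p∣H = begin
    sum (map (eval F P) (tuples F H m))  ≈⟨ sum-tuples-eval H P ⟩
    sumTerms (prodMap (powerSum H)) P    ≈⟨ sumTerms-multilinear-cong P multilinear s₀ (powerSum-1 H) ⟩
    sumTerms (prodMap (linearPart γ)) P  ≈⟨ sumTerms-concentrated (replicate m 1) (prodMap-linearPart-≢ones γ) P ⟩
    coeff F P (replicate m 1) * prodMap (linearPart γ) (replicate m 1)
      ≈⟨ *-congˡ (prodMap-linearPart-ones γ m) ⟩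
    coeff F P (replicate m 1) * pow F γ m ∎
    where
    s₀ : powerSum H 0 ≈ 0#
    s₀ = trans (powerSum-0 H) (proj₂ (isChar (length H)) p∣H)
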